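{- Let $\mathcal{A}$ be a $p\times t$ matrix and $\mathcal{B}$ a $t\times q$ matrix of formal power series in $\mathbb{R}[[x]]$. Then (a) $\mathrm{Lace}(\mathcal{A}\mathcal{B}) = \mathrm{Lace}(\mathcal{A})\,\mathrm{Lace}(\mathcal{B})$; (b) if $\mathcal{A}$ and $\mathcal{B}$ are fully interlacing, then so is $\mathcal{A}\mathcal{B}$.
   Context: A $\mathbb{Z}\times\mathbb{Z}$ real matrix is totally positive (TP) if every finite square submatrix has nonnegative determinant. For a $p\times q$ matrix $\mathcal{A} = (A_{ij}(x))_{0\le i<p,\,0\le j<q}$ of formal power series $A_{ij}(x) = \sum_{n\ge 0} a_{ij}(n)x^n$ (with $a_{ij}(n) = 0$ for $n<0$), $\mathrm{Lace}(\mathcal{A}) = (M_{uv})_{u,v\in\mathbb{Z}}$ is defined by writing $u = pu'+i$, $v = qv'+j$ with $u',v'\in\mathbb{Z}$, $0\le i<p$, $0\le j<q$, and setting $M_{uv} = a_{ij}(v'-u')$. $\mathcal{A}$ is fully interlacing if $\mathrm{Lace}(\mathcal{A})$ is TP. The product $\mathcal{A}\mathcal{B}$ is the usual matrix product over the ring $\mathbb{R}[[x]]$; the product of $\mathbb{Z}\times\mathbb{Z}$ matrices $\mathrm{Lace}(\mathcal{A})\mathrm{Lace}(\mathcal{B})$ has entries $\sum_{w\in\mathbb{Z}} M_{uw}N_{wv}$, which are finite sums here. -}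

module Defs where

open import Level using (0ℓ)
open import Data.Nat as ℕ using (ℕ; zero; suc; NonZero)
open import Data.Fin as Fin using (Fin; zero; suc; toℕ; fromℕ<; punchIn)
open import Data.Integer as ℤ using (ℤ; +_; -[1+_]; ∣_∣; _/ℕ_; _%ℕ_)
open import Data.Integer.DivMod using (n%ℕd<d)
open import Data.Product using (Σ; _×_)
open import Relation.Nullary using (¬_)
open import Relation.Binary.PropositionalEquality using (_≡_)
open import Algebra.Structures using (IsCommutativeRing)
open import Relation.Binary.Structures using (IsTotalOrder)

-- An axiomatic real field: a complete ordered field (any two models are
-- isomorphic, so quantifying over all of them = working in ℝ).

record RealField : Set₁ where
  infixl 6 _+_
  infixl 7 _*_
  infix 4 _≤_
  field
    R   : Set
    _+_ : R → R → R
    _*_ : R → R → R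
    -_  : R → R
    0#  : R
    1#  : R
    _≤_ : R → R → Set
    isCommutativeRing : IsCommutativeRing _≡_ _+_ _*_ -_ 0# 1#
    0≢1     : ¬ (0# ≡ 1#)
    inverse : ∀ x → ¬ (x ≡ 0#) → Σ R (λ y → x * y ≡ 1#)
    isTotalOrder : IsTotalOrder _≡_ _≤_
    +-mono-≤ : ∀ {x y} z → x ≤ y → x + z ≤ y + z
    *-nonneg : ∀ {x y} → 0# ≤ x → 0# ≤ y → 0# ≤ x * y
    complete : (S : R → Set) → Σ R S → Σ R (λ b → ∀ x → S x → x ≤ b) →
               Σ R (λ s → (∀ x → S x → x ≤ s) ×
                          (∀ b → (∀ x → S x → x ≤ b) → s ≤ b))

module _ (F : RealField) where
  open RealField F

  sumFin : (n : ℕ) → (Fin n → R) → R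
  sumFin zero    f = 0#
  sumFin (suc n) f = f zero + sumFin n (λ i → f (suc i))

  sumUpTo : ℕ → (ℕ → R) → R
  sumUpTo zero    f = f zero
  sumUpTo (suc n) f = sumUpTo n f + f (suc n)

  Series : Set
  Series = ℕ → R

  _·ₛ_ : Series → Series → Series
  (f ·ₛ g) n = sumUpTo n (λ k → f k * g (n ℕ.∸ k))

  PSMatrix : ℕ → ℕ → Set
  PSMatrix p q = Fin p → Fin q → Series

  matMul : {p t q : ℕ} → PSMatrix p t → PSMatrix t q → PSMatrix p q
  matMul {t = t} A B i j n = sumFin t (λ l → (A i l ·ₛ B l j) n)

  coeffℤ : Series → ℤ → R
  coeffℤ a (+ n)    = a n
  coeffℤ a -[1+ n ] = 0#

  ZMatrix : Set
  ZMatrix = ℤ → ℤ → R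

  -- Lace(A): u = p u' + i, v = q v' + j, entry a_ij(v' - u')
  Lace : {p q : ℕ} → .⦃ _ : NonZero p ⦄ → .⦃ _ : NonZero q ⦄ →
         PSMatrix p q → ZMatrix
  Lace {p} {q} A u v =
    coeffℤ (A (fromℕ< (n%ℕd<d u p)) (fromℕ< (n%ℕd<d v q)))
           ((v /ℕ q) ℤ.- (u /ℕ p))

  sign : {n : ℕ} → Fin n → R
  sign zero    = 1#
  sign (suc j) = - sign j

  det : (k : ℕ) → (Fin k → Fin k → R) → R
  det zero    M = 1#
  det (suc k) M =
    sumFin (suc k) (λ j → sign j * (M zero j * det k (λ r c → M (suc r) (punchIn j c))))

  StrictlyIncreasing : {k : ℕ} → (Fin k → ℤ) → Set
  StrictlyIncreasing f = ∀ a b → a Fin.< b → f a ℤ.< f b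

  TotallyPositive : ZMatrix → Set
  TotallyPositive M = ∀ (k : ℕ) (rows cols : Fin k → ℤ) →
    StrictlyIncreasing rows → StrictlyIncreasing cols →
    0# ≤ det k (λ a b → M (rows a) (cols b))

  FullyInterlacing : {p q : ℕ} → .⦃ _ : NonZero p ⦄ → .⦃ _ : NonZero q ⦄ →
                     PSMatrix p q → Set
  FullyInterlacing A = TotallyPositive (Lace A)

  sumSym : ℕ → (ℤ → R) → R
  sumSym N f = sumFin (suc (N ℕ.+ N)) (λ i → f ((+ toℕ i) ℤ.- (+ N)))

  FiniteSumIs : (ℤ → R) → R → Set
  FiniteSumIs f c = Σ ℕ (λ N → (∀ w → N ℕ.< ∣ w ∣ → f w ≡ 0#) × (sumSym N f ≡ c))

  IsZProduct : ZMatrix → ZMatrix → ZMatrix → Set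
  IsZProduct M N P = ∀ u v → FiniteSumIs (λ w → M u w * N w v) (P u v)

-- Writing w = l + Y t with 0 ≤ l < t, the term Lace(A)_{uw} Lace(B)_{wv} equals
-- a_{il}(Y - U) b_{lj}(V - Y), where u = p U + i and v = q V + j.  It vanishes unless
-- U ≤ Y ≤ V, and summing the rest over l and Y gives the coefficient of x^(V - U) in
-- (AB)_{ij}: this is (a).
--
-- For (b), a window [-L, L] contains every index w contributing to an entry of a given
-- k × k submatrix of Lace(AB), so that submatrix is the product of a k × (2L+1) submatrix
-- of Lace(A) and a (2L+1) × k submatrix of Lace(B).  By Cauchy–Binet its determinant is
-- a sum of products of k × k minors of Lace(A) and Lace(B), all nonnegative.
-- Cauchy–Binet is proved by induction on k through Laplace expansion along the first
-- row; the step uses that det is alternating in its rows.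

module Submission where

open import Level using (0ℓ)
open import Function using (_∘_)
open import Data.Nat as ℕ using (ℕ; zero; suc; NonZero)
import Data.Nat.Properties as ℕₚ
open import Data.Integer as ℤ using (ℤ; +_; -[1+_]; ∣_∣; _/ℕ_; _%ℕ_; 1ℤ; +<+; +≤+; -<+; -<-)
import Data.Integer.Properties as ℤₚ
open import Data.Integer.DivMod using (n%ℕd<d; a≡a%ℕn+[a/ℕn]*n; [n/ℕd]*d≤n; n<s[n/ℕd]*d)
open import Data.Integer.Tactic.RingSolver using (solve-∀)
open import Algebra.Properties.AbelianGroup ℤₚ.+-0-abelianGroup using (∙-cancelʳ)
open import Data.Sum using (_⊎_; inj₁; inj₂)
open import Data.Fin as Fin using (Fin; zero; suc; toℕ; fromℕ<; punchIn; punchOut)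
open import Data.Fin.Properties using (punchInᵢ≢i; punchOut-punchIn; punchOut-cong; toℕ-injective; toℕ-fromℕ<; toℕ<n)
open import Data.Vec as Vec using (Vec; []; _∷_; lookup)
open import Data.Vec.Properties using (lookup-map; removeAt-punchOut)
open import Data.Product using (Σ; _×_; _,_; proj₁; proj₂)
open import Data.Unit using (⊤; tt)
open import Data.Empty using (⊥-elim)
open import Relation.Nullary using (yes; no)
open import Relation.Binary.PropositionalEquality
open import Relation.Binary.Structures using (IsTotalOrder)
open import Algebra.Bundles using (CommutativeRing)
open import Defs

open ≡-Reasoning

punchIn-punchOut-comm : ∀ {n} {i j : Fin (suc (suc n))} (i≢j : i ≢ j) (j≢i : j ≢ i) (c : Fin n) →
  punchIn i (punchIn (punchOut i≢j) c) ≡ punchIn j (punchIn (punchOut j≢i) c)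
punchIn-punchOut-comm {i = zero}  {zero}  i≢j _ _ = ⊥-elim (i≢j refl)
punchIn-punchOut-comm {i = zero}  {suc j} _   _ _ = refl
punchIn-punchOut-comm {i = suc i} {zero}  _   _ _ = refl
punchIn-punchOut-comm {zero}  {suc zero} {suc zero} i≢j _ ()
punchIn-punchOut-comm {suc n} {suc i} {suc j} _ _ zero = refl
punchIn-punchOut-comm {suc n} {suc i} {suc j} i≢j j≢i (suc c) =
  cong suc (punchIn-punchOut-comm (i≢j ∘ cong suc) (j≢i ∘ cong suc) c)

removeAt-suc : {A : Set} {n : ℕ} (x : A) (xs : Vec A (suc n)) (i : Fin (suc n)) →
  Vec.removeAt (x ∷ xs) (suc i) ≡ x ∷ Vec.removeAt xs i
removeAt-suc x (y ∷ ys) i = refl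

map-removeAt : {A B : Set} {n : ℕ} (f : A → B) (xs : Vec A (suc n)) (i : Fin (suc n)) →
  Vec.map f (Vec.removeAt xs i) ≡ Vec.removeAt (Vec.map f xs) i
map-removeAt f (x ∷ xs)         zero    = refl
map-removeAt f (x ∷ xs@(_ ∷ _)) (suc i) = cong (f x ∷_) (map-removeAt f xs i)

lookup-removeAt : {A : Set} {n : ℕ} (xs : Vec A (suc n)) (i : Fin (suc n)) (j : Fin n) →
  lookup (Vec.removeAt xs i) j ≡ lookup xs (punchIn i j)
lookup-removeAt xs i j =
  trans (cong (lookup (Vec.removeAt xs i)) (sym (punchOut-punchIn i))) (removeAt-punchOut xs (punchInᵢ≢i i j ∘ sym))

Increasing : ∀ {k m} → Vec (Fin m) k → Set
Increasing S = ∀ a b → a Fin.< b → lookup S a Fin.< lookup S b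

Increasing-map-suc : ∀ {k m} (S : Vec (Fin m) k) → Increasing S → Increasing (Vec.map suc S)
Increasing-map-suc S inc a b a<b =
  subst₂ Fin._<_ (sym (lookup-map a suc S)) (sym (lookup-map b suc S)) (ℕ.s≤s (inc a b a<b))

Increasing-zero∷map-suc : ∀ {k m} (S : Vec (Fin m) k) → Increasing S → Increasing (zero ∷ Vec.map suc S)
Increasing-zero∷map-suc {m = m} S inc zero (suc b) _ =
  subst (Fin._<_ {suc m} zero) (sym (lookup-map b suc S)) (ℕ.s≤s ℕ.z≤n)
Increasing-zero∷map-suc S inc (suc a) (suc b) (ℕ.s≤s a<b) = Increasing-map-suc S inc a b a<b

finite-upperBound : ∀ n (f : Fin n → ℕ) → Σ ℕ (λ L → ∀ i → f i ℕ.≤ L)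
finite-upperBound zero    f = 0 , λ ()
finite-upperBound (suc n) f = f zero ℕ.⊔ L , bound
  where
  L = proj₁ (finite-upperBound n (λ i → f (suc i)))
  bound : ∀ i → f i ℕ.≤ f zero ℕ.⊔ L
  bound zero    = ℕₚ.m≤m⊔n (f zero) L
  bound (suc i) = ℕₚ.≤-trans (proj₂ (finite-upperBound n (λ i → f (suc i))) i) (ℕₚ.m≤n⊔m (f zero) L)

finite-upperBound² : ∀ m n (f : Fin m → Fin n → ℕ) → Σ ℕ (λ L → ∀ i j → f i j ℕ.≤ L)
finite-upperBound² m n f = proj₁ bound , λ i j → ℕₚ.≤-trans (proj₂ (rowBound i) j) (proj₂ bound i)
  where
  rowBound = λ i → finite-upperBound n (f i)
  bound = finite-upperBound m (λ i → proj₁ (rowBound i))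

i<1+j⇒i≤j : ∀ {i j} → i ℤ.< ℤ.suc j → i ℤ.≤ j
i<1+j⇒i≤j {i} {j} i<1+j = subst (i ℤ.≤_) (ℤₚ.pred-suc j) (ℤₚ.i<j⇒i≤pred[j] i<1+j)

w<X*t⇒w/t<X : ∀ t .⦃ _ : NonZero t ⦄ {w} X → w ℤ.< X ℤ.* + t → w /ℕ t ℤ.< X
w<X*t⇒w/t<X t {w} X w<Xt = ℤₚ.*-cancelʳ-<-nonNeg (+ t) (ℤₚ.≤-<-trans ([n/ℕd]*d≤n w t) w<Xt)

X*t≤w⇒X≤w/t : ∀ t .⦃ _ : NonZero t ⦄ {w} X → X ℤ.* + t ℤ.≤ w → X ℤ.≤ w /ℕ t
X*t≤w⇒X≤w/t t {w} X Xt≤w = i<1+j⇒i≤j (ℤₚ.*-cancelʳ-<-nonNeg (+ t) (ℤₚ.≤-<-trans Xt≤w (n<s[n/ℕd]*d w t)))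

[l+X*t]/t≡X : ∀ t .⦃ _ : NonZero t ⦄ {l} X → l ℕ.< t → (+ l ℤ.+ X ℤ.* + t) /ℕ t ≡ X
[l+X*t]/t≡X t {l} X l<t =
  ℤₚ.≤-antisym (i<1+j⇒i≤j (w<X*t⇒w/t<X t (ℤ.suc X) w<[1+X]t)) (X*t≤w⇒X≤w/t t X (ℤₚ.i≤j+i _ (+ l)))
  where
  w<[1+X]t : + l ℤ.+ X ℤ.* + t ℤ.< ℤ.suc X ℤ.* + t
  w<[1+X]t = subst (+ l ℤ.+ X ℤ.* + t ℤ.<_) (sym (ℤₚ.suc-* X (+ t))) (ℤₚ.+-monoˡ-< (X ℤ.* + t) (+<+ l<t))

[l+X*t]%t≡l : ∀ t .⦃ _ : NonZero t ⦄ {l} X → l ℕ.< t → (+ l ℤ.+ X ℤ.* + t) %ℕ t ≡ l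
[l+X*t]%t≡l t {l} X l<t = ℤₚ.+-injective (∙-cancelʳ (X ℤ.* + t) _ _ (begin
  + (w %ℕ t) ℤ.+ X ℤ.* + t           ≡⟨ cong (λ q → + (w %ℕ t) ℤ.+ q ℤ.* + t) ([l+X*t]/t≡X t X l<t) ⟨
  + (w %ℕ t) ℤ.+ (w /ℕ t) ℤ.* + t    ≡⟨ a≡a%ℕn+[a/ℕn]*n w t ⟨
  w                                  ∎))
  where
  w = + l ℤ.+ X ℤ.* + t

i-j≡k⇒i≡k+j : ∀ i j {k} → i ℤ.- j ≡ k → i ≡ k ℤ.+ j
i-j≡k⇒i≡k+j i j i-j≡k = trans (sym (identity i j)) (cong (ℤ._+ j) i-j≡k)
  where
  identity : ∀ i j → (i ℤ.- j) ℤ.+ j ≡ i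
  identity = solve-∀

i-j≡-[1+n]⇒i<j : ∀ i j {n} → i ℤ.- j ≡ -[1+ n ] → i ℤ.< j
i-j≡-[1+n]⇒i<j i j i-j≡-[1+n] =
  subst₂ ℤ._<_ (sym (i-j≡k⇒i≡k+j i j i-j≡-[1+n])) (ℤₚ.+-identityˡ j) (ℤₚ.+-monoˡ-< j (-<+ {n = 0}))

U*t+[1+n]*t≡[1+V]*t : ∀ U V t n → V ℤ.- U ≡ + n → U ℤ.* + t ℤ.+ + (suc n ℕ.* t) ≡ ℤ.suc V ℤ.* + t
U*t+[1+n]*t≡[1+V]*t U V t n V-U≡n = begin
  U ℤ.* + t ℤ.+ + (suc n ℕ.* t)          ≡⟨ cong (λ x → U ℤ.* + t ℤ.+ x) (ℤₚ.pos-* (suc n) t) ⟩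
  U ℤ.* + t ℤ.+ + suc n ℤ.* + t          ≡⟨ identity U (+ n) (+ t) ⟩
  ℤ.suc (+ n ℤ.+ U) ℤ.* + t              ≡⟨ cong (λ V → ℤ.suc V ℤ.* + t) (i-j≡k⇒i≡k+j V U V-U≡n) ⟨
  ℤ.suc V ℤ.* + t                        ∎
  where
  identity : ∀ U n t → U ℤ.* t ℤ.+ (1ℤ ℤ.+ n) ℤ.* t ≡ (1ℤ ℤ.+ (n ℤ.+ U)) ℤ.* t
  identity = solve-∀

-N+[1+2N]≡1+N : ∀ N → ℤ.- (+ N) ℤ.+ + suc (N ℕ.+ N) ≡ + suc N
-N+[1+2N]≡1+N N = identity (+ N)
  where
  identity : ∀ n → ℤ.- n ℤ.+ (1ℤ ℤ.+ (n ℤ.+ n)) ≡ 1ℤ ℤ.+ n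
  identity = solve-∀

n<∣i∣⇒i<-n⊎n<i : ∀ n i → n ℕ.< ∣ i ∣ → i ℤ.< ℤ.- (+ n) ⊎ + n ℤ.< i
n<∣i∣⇒i<-n⊎n<i n       (+ m)    n<m         = inj₂ (+<+ n<m)
n<∣i∣⇒i<-n⊎n<i zero    -[1+ m ] _           = inj₁ -<+
n<∣i∣⇒i<-n⊎n<i (suc n) -[1+ m ] (ℕ.s≤s n<m) = inj₁ (-<- n<m)

i<-n⇒n<∣i∣ : ∀ {n i} → i ℤ.< ℤ.- (+ n) → n ℕ.< ∣ i ∣
i<-n⇒n<∣i∣ {zero}  { -[1+ m ]} _         = ℕ.s≤s ℕ.z≤n
i<-n⇒n<∣i∣ {suc n} { -[1+ m ]} (-<- n<m) = ℕ.s≤s n<m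
i<-n⇒n<∣i∣ {zero}  {+ m}       (+<+ ())
i<-n⇒n<∣i∣ {suc n} {+ m}       ()

+n<i⇒n<∣i∣ : ∀ {n i} → + n ℤ.< i → n ℕ.< ∣ i ∣
+n<i⇒n<∣i∣ (+<+ n<m) = n<m

-∣i∣≤i : ∀ i → ℤ.- (+ ∣ i ∣) ℤ.≤ i
-∣i∣≤i (+ n)    = ℤₚ.neg-≤-pos
-∣i∣≤i -[1+ n ] = ℤₚ.≤-refl

i≤+∣i∣ : ∀ i → i ℤ.≤ + ∣ i ∣
i≤+∣i∣ (+ n)    = ℤₚ.≤-refl
i≤+∣i∣ -[1+ n ] = ℤ.-≤+

module _ (F : RealField) where
  open RealField F

  commutativeRing : CommutativeRing 0ℓ 0ℓ
  commutativeRing = record { isCommutativeRing = isCommutativeRing }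

  open CommutativeRing commutativeRing
    using (+-assoc; +-comm; *-comm; +-identityˡ; +-identityʳ; *-identityˡ; *-identityʳ;
           distribˡ; distribʳ; zeroˡ; zeroʳ; -‿inverseʳ; ring; semiring; *-commutativeMonoid; +-commutativeSemigroup)
  open import Algebra.Properties.Ring ring using (-‿distribˡ-*; -‿distribʳ-*; -‿involutive; -0#≈0#; -‿+-comm)
  open import Algebra.Properties.Semiring.Sum semiring
    using (sum; sum-cong-≗; sum-replicate-zero; ∑-distrib-+; ∑-comm; sum-remove; *-distribˡ-sum; *-distribʳ-sum)

  open import Algebra.Solver.CommutativeMonoid *-commutativeMonoid using (solve; _⊕_; _⊜_)
  open import Algebra.Properties.CommutativeSemigroup +-commutativeSemigroup
    using () renaming (interchange to +-interchange)

  -x*-y≡x*y : ∀ x y → (- x) * (- y) ≡ x * y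
  -x*-y≡x*y x y = begin
    (- x) * (- y)    ≡⟨ -‿distribˡ-* x (- y) ⟨
    - (x * (- y))    ≡⟨ cong -_ (-‿distribʳ-* x y) ⟨
    - (- (x * y))    ≡⟨ -‿involutive (x * y) ⟩
    x * y            ∎

  sumFin≡sum : ∀ n (f : Fin n → R) → sumFin F n f ≡ sum f
  sumFin≡sum zero    f = refl
  sumFin≡sum (suc n) f = cong (λ s → f zero + s) (sumFin≡sum n (f ∘ suc))

  sumFin-cong : ∀ n {f g : Fin n → R} → (∀ i → f i ≡ g i) → sumFin F n f ≡ sumFin F n g
  sumFin-cong n {f} {g} f≗g = begin
    sumFin F n f  ≡⟨ sumFin≡sum n f ⟩
    sum f         ≡⟨ sum-cong-≗ f≗g ⟩
    sum g         ≡⟨ sumFin≡sum n g ⟨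
    sumFin F n g  ∎

  sumFin-zero : ∀ n {f : Fin n → R} → (∀ i → f i ≡ 0#) → sumFin F n f ≡ 0#
  sumFin-zero n f≗0 = trans (sumFin-cong n f≗0) (trans (sumFin≡sum n _) (sum-replicate-zero n))

  sumFin-+ : ∀ n (f g : Fin n → R) → sumFin F n (λ i → f i + g i) ≡ sumFin F n f + sumFin F n g
  sumFin-+ n f g = begin
    sumFin F n (λ i → f i + g i)  ≡⟨ sumFin≡sum n _ ⟩
    sum (λ i → f i + g i)         ≡⟨ ∑-distrib-+ f g ⟩
    sum f + sum g                 ≡⟨ cong₂ _+_ (sumFin≡sum n f) (sumFin≡sum n g) ⟨
    sumFin F n f + sumFin F n g   ∎

  sumFin-*ˡ : ∀ n c (f : Fin n → R) → c * sumFin F n f ≡ sumFin F n (λ i → c * f i)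
  sumFin-*ˡ n c f = begin
    c * sumFin F n f             ≡⟨ cong (c *_) (sumFin≡sum n f) ⟩
    c * sum f                    ≡⟨ *-distribˡ-sum c f ⟩
    sum (λ i → c * f i)          ≡⟨ sumFin≡sum n _ ⟨
    sumFin F n (λ i → c * f i)   ∎

  sumFin-*ʳ : ∀ n c (f : Fin n → R) → sumFin F n f * c ≡ sumFin F n (λ i → f i * c)
  sumFin-*ʳ n c f = begin
    sumFin F n f * c             ≡⟨ cong (_* c) (sumFin≡sum n f) ⟩
    sum f * c                    ≡⟨ *-distribʳ-sum c f ⟩
    sum (λ i → f i * c)          ≡⟨ sumFin≡sum n _ ⟨
    sumFin F n (λ i → f i * c)   ∎

  sumFin-neg : ∀ n (f : Fin n → R) → - sumFin F n f ≡ sumFin F n (λ i → - f i)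
  sumFin-neg zero    f = -0#≈0#
  sumFin-neg (suc n) f = trans (sym (-‿+-comm _ _)) (cong (λ s → - f zero + s) (sumFin-neg n (f ∘ suc)))

  sumFin-comm : ∀ m n (f : Fin m → Fin n → R) →
    sumFin F m (λ i → sumFin F n (f i)) ≡ sumFin F n (λ j → sumFin F m (λ i → f i j))
  sumFin-comm m n f = begin
    sumFin F m (λ i → sumFin F n (f i))          ≡⟨ sumFin-cong m (λ i → sumFin≡sum n (f i)) ⟩
    sumFin F m (λ i → sum (f i))                 ≡⟨ sumFin≡sum m _ ⟩
    sum (λ i → sum (f i))                        ≡⟨ ∑-comm f ⟩
    sum (λ j → sum (λ i → f i j))                ≡⟨ sumFin≡sum n _ ⟨
    sumFin F n (λ j → sum (λ i → f i j))         ≡⟨ sumFin-cong n (λ j → sumFin≡sum m (λ i → f i j)) ⟨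
    sumFin F n (λ j → sumFin F m (λ i → f i j))  ∎

  sumFin-punchIn : ∀ n (j : Fin (suc n)) (f : Fin (suc n) → R) →
    sumFin F (suc n) f ≡ f j + sumFin F n (f ∘ punchIn j)
  sumFin-punchIn n j f = begin
    sumFin F (suc n) f               ≡⟨ sumFin≡sum (suc n) f ⟩
    sum f                            ≡⟨ sum-remove {i = j} f ⟩
    f j + sum (f ∘ punchIn j)        ≡⟨ cong (λ s → f j + s) (sumFin≡sum n _) ⟨
    f j + sumFin F n (f ∘ punchIn j) ∎

  sumFin²-antisymmetric : ∀ n (a : Fin n → Fin n → R) →
    (∀ i j → a i j ≡ - a j i) → (∀ i → a i i ≡ 0#) → sumFin F n (λ i → sumFin F n (a i)) ≡ 0#
  sumFin²-antisymmetric zero    a anti diag = refl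
  sumFin²-antisymmetric (suc n) a anti diag = begin
    (a zero zero + row₀) + sumFin F n (λ i → a (suc i) zero + inner i)
      ≡⟨ cong₂ _+_ (cong (_+ row₀) (diag zero)) (sumFin-+ n _ inner) ⟩
    (0# + row₀) + (col₀ + sumFin F n inner)
      ≡⟨ cong₂ (λ x y → x + (col₀ + y)) (+-identityˡ row₀) inner≡0 ⟩
    row₀ + (col₀ + 0#)
      ≡⟨ cong (λ s → row₀ + s) (+-identityʳ col₀) ⟩
    row₀ + col₀
      ≡⟨ cong (λ s → row₀ + s) col₀≡-row₀ ⟩
    row₀ + - row₀
      ≡⟨ -‿inverseʳ row₀ ⟩
    0# ∎
    where
    row₀ = sumFin F n (λ j → a zero (suc j))
    col₀ = sumFin F n (λ i → a (suc i) zero)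
    inner = λ i → sumFin F n (λ j → a (suc i) (suc j))
    inner≡0 = sumFin²-antisymmetric n (λ i j → a (suc i) (suc j)) (λ i j → anti (suc i) (suc j)) (diag ∘ suc)
    col₀≡-row₀ : col₀ ≡ - row₀
    col₀≡-row₀ = trans (sumFin-cong n (λ i → anti (suc i) zero)) (sym (sumFin-neg n _))

  bilinear : ∀ {n} → (Fin n → Fin n → R) → (Fin n → R) → (Fin n → R) → R
  bilinear {n} b x y = sumFin F n (λ i → sumFin F n (λ j → (x i * y j) * b i j))

  bilinear-self : ∀ {n} (b : Fin n → Fin n → R) (x : Fin n → R) →
    (∀ i j → b i j ≡ - b j i) → (∀ i → b i i ≡ 0#) → bilinear b x x ≡ 0#
  bilinear-self {n} b x anti diag = sumFin²-antisymmetric n (λ i j → (x i * x j) * b i j) anti′ diag′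
    where
    anti′ : ∀ i j → (x i * x j) * b i j ≡ - ((x j * x i) * b j i)
    anti′ i j = trans (cong₂ _*_ (*-comm (x i) (x j)) (anti i j)) (sym (-‿distribʳ-* _ _))
    diag′ : ∀ i → (x i * x i) * b i i ≡ 0#
    diag′ i = trans (cong (x i * x i *_) (diag i)) (zeroʳ _)

  bilinear-swap : ∀ {n} (b : Fin n → Fin n → R) (x y : Fin n → R) →
    (∀ i j → b i j ≡ - b j i) → bilinear b y x ≡ - bilinear b x y
  bilinear-swap {n} b x y anti = begin
    sumFin F n (λ i → sumFin F n (λ j → (y i * x j) * b i j))    ≡⟨ sumFin-comm n n _ ⟩
    sumFin F n (λ j → sumFin F n (λ i → (y i * x j) * b i j))    ≡⟨ sumFin-cong n (λ j → sumFin-cong n (λ i → swapped j i)) ⟩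
    sumFin F n (λ j → sumFin F n (λ i → - ((x j * y i) * b j i))) ≡⟨ sumFin-cong n (λ j → sumFin-neg n _) ⟨
    sumFin F n (λ j → - sumFin F n (λ i → (x j * y i) * b j i))   ≡⟨ sumFin-neg n _ ⟨
    - bilinear b x y                                              ∎
    where
    swapped : ∀ j i → (y i * x j) * b i j ≡ - ((x j * y i) * b j i)
    swapped j i = trans (cong₂ _*_ (*-comm (y i) (x j)) (anti i j)) (sym (-‿distribʳ-* _ _))

  -- Determinants are alternating

  det-cong : ∀ k {M N : Fin k → Fin k → R} → (∀ a b → M a b ≡ N a b) → det F k M ≡ det F k N
  det-cong zero    M≗N = refl
  det-cong (suc k) M≗N = sumFin-cong (suc k) (λ j → cong (sign F j *_)
    (cong₂ _*_ (M≗N zero j) (det-cong k (λ r c → M≗N (suc r) (punchIn j c)))))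

  sign-punchOut : ∀ {n} {i j : Fin (suc (suc n))} (i≢j : i ≢ j) (j≢i : j ≢ i) →
    sign F i * sign F (punchOut i≢j) ≡ - (sign F j * sign F (punchOut j≢i))
  sign-punchOut {i = zero}  {zero}  i≢j _ = ⊥-elim (i≢j refl)
  sign-punchOut {i = zero}  {suc j} _   _ = begin
    1# * sign F j          ≡⟨ *-identityˡ _ ⟩
    sign F j               ≡⟨ -‿involutive _ ⟨
    - (- sign F j)         ≡⟨ cong -_ (*-identityʳ _) ⟨
    - ((- sign F j) * 1#)  ∎
  sign-punchOut {i = suc i} {zero}  _   _ = trans (*-identityʳ _) (cong -_ (sym (*-identityˡ _)))
  sign-punchOut {zero}  {suc zero} {suc zero} i≢j _ = ⊥-elim (i≢j refl)
  sign-punchOut {suc n} {suc i} {suc j} i≢j j≢i = begin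
    (- sign F i) * (- sign F (punchOut i≢j′))       ≡⟨ -x*-y≡x*y _ _ ⟩
    sign F i * sign F (punchOut i≢j′)               ≡⟨ sign-punchOut i≢j′ j≢i′ ⟩
    - (sign F j * sign F (punchOut j≢i′))           ≡⟨ cong -_ (-x*-y≡x*y _ _) ⟨
    - ((- sign F j) * (- sign F (punchOut j≢i′)))   ∎
    where
    i≢j′ = i≢j ∘ cong suc
    j≢i′ = j≢i ∘ cong suc

  cofactor₂ : ∀ {n} → (Fin n → Fin (suc (suc n)) → R) → Fin (suc (suc n)) → Fin (suc (suc n)) → R
  cofactor₂ {n} Y i j with i Fin.≟ j
  ... | yes _   = 0#
  ... | no  i≢j = (sign F i * sign F (punchOut i≢j)) * det F n (λ r c → Y r (punchIn i (punchIn (punchOut i≢j) c)))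

  cofactor₂-diagonal : ∀ {n} (Y : Fin n → Fin (suc (suc n)) → R) i → cofactor₂ Y i i ≡ 0#
  cofactor₂-diagonal Y i with i Fin.≟ i
  ... | yes _  = refl
  ... | no i≢i = ⊥-elim (i≢i refl)

  cofactor₂-antisymmetric : ∀ {n} (Y : Fin n → Fin (suc (suc n)) → R) i j → cofactor₂ Y i j ≡ - cofactor₂ Y j i
  cofactor₂-antisymmetric {n} Y i j with i Fin.≟ j | j Fin.≟ i
  ... | yes _   | yes _   = sym -0#≈0#
  ... | yes i≡j | no j≢i  = ⊥-elim (j≢i (sym i≡j))
  ... | no i≢j  | yes j≡i = ⊥-elim (i≢j (sym j≡i))
  ... | no i≢j  | no j≢i  = trans
    (cong₂ _*_ (sign-punchOut i≢j j≢i) (det-cong n (λ r c → cong (Y r) (punchIn-punchOut-comm i≢j j≢i c))))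
    (sym (-‿distribˡ-* _ _))

  cofactor₂-punchIn : ∀ {n} (Y : Fin n → Fin (suc (suc n)) → R) i c →
    cofactor₂ Y i (punchIn i c) ≡ (sign F i * sign F c) * det F n (λ r c′ → Y r (punchIn i (punchIn c c′)))
  cofactor₂-punchIn {n} Y i c with i Fin.≟ punchIn i c
  ... | yes i≡ = ⊥-elim (punchInᵢ≢i i c (sym i≡))
  ... | no  i≢ = cong (λ d → (sign F i * sign F d) * det F n (λ r c′ → Y r (punchIn i (punchIn d c′))))
                      (trans (punchOut-cong i refl) (punchOut-punchIn i))

  det-expand₂ : ∀ n (M : Fin (suc (suc n)) → Fin (suc (suc n)) → R) →
    det F (suc (suc n)) M ≡ bilinear (cofactor₂ (λ r → M (suc (suc r)))) (M zero) (M (suc zero))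
  det-expand₂ n M = sumFin-cong (suc (suc n)) λ i → begin
    sign F i * (x i * sumFin F (suc n) (λ c → sign F c * (y (punchIn i c) * D i c)))
      ≡⟨ cong (sign F i *_) (sumFin-*ˡ (suc n) (x i) (λ c → sign F c * (y (punchIn i c) * D i c))) ⟩
    sign F i * sumFin F (suc n) (λ c → x i * (sign F c * (y (punchIn i c) * D i c)))
      ≡⟨ sumFin-*ˡ (suc n) (sign F i) (λ c → x i * (sign F c * (y (punchIn i c) * D i c))) ⟩
    sumFin F (suc n) (λ c → sign F i * (x i * (sign F c * (y (punchIn i c) * D i c))))
      ≡⟨ sumFin-cong (suc n) (λ c → trans (regroup _ _ _ _ _) (cong (x i * y (punchIn i c) *_) (sym (cofactor₂-punchIn Y i c)))) ⟩
    off-diagonal i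
      ≡⟨ +-identityˡ (off-diagonal i) ⟨
    0# + off-diagonal i
      ≡⟨ cong (_+ off-diagonal i) (trans (cong (x i * y i *_) (cofactor₂-diagonal Y i)) (zeroʳ _)) ⟨
    (x i * y i) * b i i + off-diagonal i
      ≡⟨ sumFin-punchIn (suc n) i (λ j → (x i * y j) * b i j) ⟨
    sumFin F (suc (suc n)) (λ j → (x i * y j) * b i j) ∎
    where
    x = M zero
    y = M (suc zero)
    Y = λ r → M (suc (suc r))
    b = cofactor₂ Y
    D : Fin (suc (suc n)) → Fin (suc n) → R
    D i c = det F n (λ r c′ → Y r (punchIn i (punchIn c c′)))
    off-diagonal : Fin (suc (suc n)) → R
    off-diagonal i = sumFin F (suc n) (λ c → (x i * y (punchIn i c)) * b i (punchIn i c))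
    regroup : ∀ s a t e d → s * (a * (t * (e * d))) ≡ (a * e) * ((s * t) * d)
    regroup = solve 5 (λ s a t e d → s ⊕ (a ⊕ (t ⊕ (e ⊕ d))) ⊜ (a ⊕ e) ⊕ ((s ⊕ t) ⊕ d)) refl

  mutual
    Alternating : {A : Set} (n : ℕ) → (Vec A n → R) → Set
    Alternating zero          Φ = ⊤
    Alternating (suc zero)    Φ = ⊤
    Alternating (suc (suc n)) Φ = Alternating₂ n Φ

    record Alternating₂ {A : Set} (n : ℕ) (Φ : Vec A (suc (suc n)) → R) : Set where
      inductive
      field
        repeated : ∀ a r → Φ (a ∷ a ∷ r) ≡ 0#
        swapped  : ∀ a b r → Φ (a ∷ b ∷ r) ≡ - Φ (b ∷ a ∷ r)
        tail     : ∀ a → Alternating (suc n) (λ v → Φ (a ∷ v))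

  open Alternating₂

  Alternating-map : {A B : Set} → ∀ n (f : A → B) {Φ : Vec B n → R} → Alternating n Φ → Alternating n (Φ ∘ Vec.map f)
  Alternating-map zero          f alt = tt
  Alternating-map (suc zero)    f alt = tt
  Alternating-map (suc (suc n)) f alt = record
    { repeated = λ a r → repeated alt (f a) (Vec.map f r)
    ; swapped  = λ a b r → swapped alt (f a) (f b) (Vec.map f r)
    ; tail     = λ a → Alternating-map (suc n) f (tail alt (f a))
    }

  Alternating-scale : {A : Set} → ∀ n c {Φ : Vec A n → R} → Alternating n Φ → Alternating n (λ v → c * Φ v)
  Alternating-scale zero          c alt = tt
  Alternating-scale (suc zero)    c alt = tt
  Alternating-scale (suc (suc n)) c alt = record
    { repeated = λ a r → trans (cong (c *_) (repeated alt a r)) (zeroʳ c)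
    ; swapped  = λ a b r → trans (cong (c *_) (swapped alt a b r)) (sym (-‿distribʳ-* c _))
    ; tail     = λ a → Alternating-scale (suc n) c (tail alt a)
    }

  Alternating-sum : {A : Set} → ∀ n K (Φ : Fin K → Vec A n → R) → (∀ j → Alternating n (Φ j)) →
    Alternating n (λ v → sumFin F K (λ j → Φ j v))
  Alternating-sum zero          K Φ alt = tt
  Alternating-sum (suc zero)    K Φ alt = tt
  Alternating-sum (suc (suc n)) K Φ alt = record
    { repeated = λ a r → sumFin-zero K (λ j → repeated (alt j) a r)
    ; swapped  = λ a b r → trans (sumFin-cong K (λ j → swapped (alt j) a b r)) (sym (sumFin-neg K _))
    ; tail     = λ a → Alternating-sum (suc n) K (λ j v → Φ j (a ∷ v)) (λ j → tail (alt j) a)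
    }

  detRows : {A : Set} → ∀ n → (A → Fin n → R) → Vec A n → R
  detRows n N v = det F n (λ a b → N (lookup v a) b)

  -- Expanded along its first two rows, det is a bilinear form in them whose kernel cofactor₂
  -- is antisymmetric with zero diagonal; the other rows are handled by expanding along the first.
  detRows-alternating : {A : Set} → ∀ n (N : A → Fin n → R) → Alternating n (detRows n N)
  detRows-alternating zero          N = tt
  detRows-alternating (suc zero)    N = tt
  detRows-alternating (suc (suc n)) N = record
    { repeated = λ a r → trans (det-expand₂ n (rows (a ∷ a ∷ r))) (bilinear-self (κ r) (N a) (anti r) (diag r))
    ; swapped  = λ a b r → begin
        detRows (suc (suc n)) N (a ∷ b ∷ r)   ≡⟨ det-expand₂ n (rows (a ∷ b ∷ r)) ⟩
        bilinear (κ r) (N a) (N b)            ≡⟨ bilinear-swap (κ r) (N b) (N a) (anti r) ⟩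
        - bilinear (κ r) (N b) (N a)          ≡⟨ cong -_ (det-expand₂ n (rows (b ∷ a ∷ r))) ⟨
        - detRows (suc (suc n)) N (b ∷ a ∷ r) ∎
    ; tail     = λ a → Alternating-sum (suc n) (suc (suc n)) _ (λ j →
        Alternating-scale (suc n) (sign F j) (Alternating-scale (suc n) (N a j)
          (detRows-alternating (suc n) (λ w c → N w (punchIn j c)))))
    }
    where
    rows : Vec _ (suc (suc n)) → Fin (suc (suc n)) → Fin (suc (suc n)) → R
    rows v i = N (lookup v i)
    κ : Vec _ n → Fin (suc (suc n)) → Fin (suc (suc n)) → R
    κ r = cofactor₂ (λ i → N (lookup r i))
    anti = λ r → cofactor₂-antisymmetric (λ i → N (lookup r i))
    diag = λ r → cofactor₂-diagonal (λ i → N (lookup r i))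

  -- Cauchy–Binet

  -- The sum of G over the strictly increasing k-tuples in Fin m, i.e. over the k-subsets of Fin m.
  sumSubsets : ∀ k m → (Vec (Fin m) k → R) → R
  sumSubsets zero    m       G = G []
  sumSubsets (suc k) zero    G = 0#
  sumSubsets (suc k) (suc m) G =
    sumSubsets k m (λ S → G (zero ∷ Vec.map suc S)) + sumSubsets (suc k) m (λ S → G (Vec.map suc S))

  sumSubsets-cong : ∀ k m {G H : Vec (Fin m) k → R} → (∀ S → G S ≡ H S) → sumSubsets k m G ≡ sumSubsets k m H
  sumSubsets-cong zero    m       G≗H = G≗H []
  sumSubsets-cong (suc k) zero    G≗H = refl
  sumSubsets-cong (suc k) (suc m) G≗H =
    cong₂ _+_ (sumSubsets-cong k m (λ S → G≗H _)) (sumSubsets-cong (suc k) m (λ S → G≗H _))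

  sumSubsets-+ : ∀ k m (G H : Vec (Fin m) k → R) →
    sumSubsets k m (λ S → G S + H S) ≡ sumSubsets k m G + sumSubsets k m H
  sumSubsets-+ zero    m       G H = refl
  sumSubsets-+ (suc k) zero    G H = sym (+-identityˡ 0#)
  sumSubsets-+ (suc k) (suc m) G H =
    trans (cong₂ _+_ (sumSubsets-+ k m _ _) (sumSubsets-+ (suc k) m _ _)) (+-interchange _ _ _ _)

  sumSubsets-neg : ∀ k m (G : Vec (Fin m) k → R) → sumSubsets k m (λ S → - G S) ≡ - sumSubsets k m G
  sumSubsets-neg zero    m       G = refl
  sumSubsets-neg (suc k) zero    G = sym -0#≈0#
  sumSubsets-neg (suc k) (suc m) G =
    trans (cong₂ _+_ (sumSubsets-neg k m _) (sumSubsets-neg (suc k) m _)) (-‿+-comm _ _)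

  sumSubsets-*ˡ : ∀ k m c (G : Vec (Fin m) k → R) → c * sumSubsets k m G ≡ sumSubsets k m (λ S → c * G S)
  sumSubsets-*ˡ zero    m       c G = refl
  sumSubsets-*ˡ (suc k) zero    c G = zeroʳ c
  sumSubsets-*ˡ (suc k) (suc m) c G =
    trans (distribˡ c _ _) (cong₂ _+_ (sumSubsets-*ˡ k m c _) (sumSubsets-*ˡ (suc k) m c _))

  sumSubsets-sumFin : ∀ k m n (G : Fin n → Vec (Fin m) k → R) →
    sumSubsets k m (λ S → sumFin F n (λ j → G j S)) ≡ sumFin F n (λ j → sumSubsets k m (G j))
  sumSubsets-sumFin zero    m       n G = refl
  sumSubsets-sumFin (suc k) zero    n G = sym (sumFin-zero n (λ _ → refl))
  sumSubsets-sumFin (suc k) (suc m) n G =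
    trans (cong₂ _+_ (sumSubsets-sumFin k m n _) (sumSubsets-sumFin (suc k) m n _)) (sym (sumFin-+ n _ _))

  -- The exterior product (x ∧ G)(T) of a linear form x and a k-form G.
  wedge : ∀ {k m} → (Fin m → R) → (Vec (Fin m) k → R) → Vec (Fin m) (suc k) → R
  wedge {k} x G T = sumFin F (suc k) (λ i → sign F i * (x (lookup T i) * G (Vec.removeAt T i)))

  wedge-map-suc : ∀ {k m} (x : Fin (suc m) → R) (G : Vec (Fin (suc m)) k → R) (T : Vec (Fin m) (suc k)) →
    wedge x G (Vec.map suc T) ≡ wedge (λ w → x (suc w)) (λ S → G (Vec.map suc S)) T
  wedge-map-suc {k} x G T = sumFin-cong (suc k) (λ i → cong (sign F i *_)
    (cong₂ _*_ (cong x (lookup-map i suc T)) (cong G (sym (map-removeAt suc T i)))))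

  wedge-zero∷map-suc : ∀ {k m} (x : Fin (suc m) → R) (G : Vec (Fin (suc m)) (suc k) → R) (T : Vec (Fin m) (suc k)) →
    wedge x G (zero ∷ Vec.map suc T) ≡
    x zero * G (Vec.map suc T) + - wedge (λ w → x (suc w)) (λ S → G (zero ∷ Vec.map suc S)) T
  wedge-zero∷map-suc {k} x G T = cong₂ _+_ (*-identityˡ _) (begin
    sumFin F (suc k) (λ i → (- sign F i) * (x (lookup (Vec.map suc T) i) * G (Vec.removeAt (zero ∷ Vec.map suc T) (suc i))))
      ≡⟨ sumFin-cong (suc k) (λ i → trans (sym (-‿distribˡ-* _ _)) (cong -_ (cong (sign F i *_) (cong₂ _*_
           (cong x (lookup-map i suc T))
           (cong G (trans (removeAt-suc zero (Vec.map suc T) i) (cong (zero ∷_) (sym (map-removeAt suc T i))))))))) ⟩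
    sumFin F (suc k) (λ i → - (sign F i * (x (suc (lookup T i)) * G (zero ∷ Vec.map suc (Vec.removeAt T i)))))
      ≡⟨ sumFin-neg (suc k) (λ i → sign F i * (x (suc (lookup T i)) * G (zero ∷ Vec.map suc (Vec.removeAt T i)))) ⟨
    - wedge (λ w → x (suc w)) (λ S → G (zero ∷ Vec.map suc S)) T ∎)

  -- For w ∉ S, w ∷ S is the increasing tuple T = S ∪ {w} with its i-th entry moved to the
  -- front, so G S * x w * Φ (w ∷ S) is the i-th term of wedge x G T * Φ T; the terms with
  -- w ∈ S vanish.
  sumSubsets-wedge : ∀ k m (x : Fin m → R) (G : Vec (Fin m) k → R) {Φ : Vec (Fin m) (suc k) → R} →
    Alternating (suc k) Φ →
    sumSubsets k m (λ S → G S * sumFin F m (λ w → x w * Φ (w ∷ S))) ≡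
    sumSubsets (suc k) m (λ T → wedge x G T * Φ T)
  sumSubsets-wedge zero    zero    x G alt = zeroʳ (G [])
  sumSubsets-wedge (suc k) zero    x G alt = refl
  sumSubsets-wedge zero    (suc m) x G {Φ} alt = begin
    G [] * (x zero * Φ (zero ∷ []) + sumFin F m (λ w → x (suc w) * Φ (suc w ∷ [])))
      ≡⟨ distribˡ (G []) _ _ ⟩
    G [] * (x zero * Φ (zero ∷ [])) + G [] * sumFin F m (λ w → x (suc w) * Φ (suc w ∷ []))
      ≡⟨ cong₂ _+_ first rest ⟩
    wedge x G (zero ∷ []) * Φ (zero ∷ []) + sumSubsets 1 m (λ T → wedge x G (Vec.map suc T) * Φ (Vec.map suc T)) ∎
    where
    first : G [] * (x zero * Φ (zero ∷ [])) ≡ (1# * (x zero * G []) + 0#) * Φ (zero ∷ [])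
    first = trans (solve 3 (λ g a f → g ⊕ (a ⊕ f) ⊜ (a ⊕ g) ⊕ f) refl (G []) (x zero) (Φ (zero ∷ [])))
                  (cong (_* Φ (zero ∷ [])) (sym (trans (+-identityʳ _) (*-identityˡ _))))
    rest = trans (sumSubsets-wedge zero m (λ w → x (suc w)) (λ S → G (Vec.map suc S)) tt)
                 (sumSubsets-cong 1 m (λ T → cong (_* Φ (Vec.map suc T)) (sym (wedge-map-suc x G T))))
  sumSubsets-wedge (suc k) (suc m) x G {Φ} alt = begin
    sumSubsets k m (λ S → L (zero ∷ Vec.map suc S)) + sumSubsets (suc k) m (λ S → L (Vec.map suc S))
      ≡⟨ cong₂ _+_ (sumSubsets-cong k m L-zero) (sumSubsets-cong (suc k) m L-suc) ⟩
    sumSubsets k m (λ S → - P S) + sumSubsets (suc k) m (λ S → A S + Q S)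
      ≡⟨ cong₂ _+_ (sumSubsets-neg k m P) (sumSubsets-+ (suc k) m A Q) ⟩
    - sumSubsets k m P + (sumSubsets (suc k) m A + sumSubsets (suc k) m Q)
      ≡⟨ cong₂ (λ p q → - p + (sumSubsets (suc k) m A + q)) IH₁ IH₂ ⟩
    - ΣP′ + (ΣA + ΣQ′)
      ≡⟨ trans (sym (+-assoc (- ΣP′) ΣA ΣQ′)) (cong (_+ ΣQ′) (+-comm (- ΣP′) ΣA)) ⟩
    (ΣA + - ΣP′) + ΣQ′
      ≡⟨ cong (_+ ΣQ′) (trans (sumSubsets-+ (suc k) m A (λ T → - P′ T)) (cong (λ s → ΣA + s) (sumSubsets-neg (suc k) m P′))) ⟨
    sumSubsets (suc k) m (λ T → A T + - P′ T) + ΣQ′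
      ≡⟨ cong₂ _+_ (sumSubsets-cong (suc k) m W-zero) (sumSubsets-cong (suc (suc k)) m W-suc) ⟨
    sumSubsets (suc k) m (λ T → W (zero ∷ Vec.map suc T)) + sumSubsets (suc (suc k)) m (λ T → W (Vec.map suc T)) ∎
    where
    x′ = λ w → x (suc w)
    G′ = λ S → G (Vec.map suc S)
    G″ = λ S → G (zero ∷ Vec.map suc S)
    Φ′ = λ v → Φ (Vec.map suc v)
    Φ″ = λ v → Φ (zero ∷ Vec.map suc v)
    L : Vec (Fin (suc m)) (suc k) → R
    L S = G S * sumFin F (suc m) (λ w → x w * Φ (w ∷ S))
    W : Vec (Fin (suc m)) (suc (suc k)) → R
    W T = wedge x G T * Φ T
    P : Vec (Fin m) k → R
    P S = G″ S * sumFin F m (λ w → x′ w * Φ″ (w ∷ S))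
    Q A : Vec (Fin m) (suc k) → R
    Q S = G′ S * sumFin F m (λ w → x′ w * Φ′ (w ∷ S))
    A S = (x zero * G′ S) * Φ″ S
    P′ : Vec (Fin m) (suc k) → R
    P′ T = wedge x′ G″ T * Φ″ T
    Q′ : Vec (Fin m) (suc (suc k)) → R
    Q′ T = wedge x′ G′ T * Φ′ T
    ΣA = sumSubsets (suc k) m A
    ΣP′ = sumSubsets (suc k) m P′
    ΣQ′ = sumSubsets (suc (suc k)) m Q′
    IH₁ : sumSubsets k m P ≡ ΣP′
    IH₁ = sumSubsets-wedge k m x′ G″ (Alternating-map (suc k) suc (tail alt zero))
    IH₂ : sumSubsets (suc k) m Q ≡ ΣQ′
    IH₂ = sumSubsets-wedge (suc k) m x′ G′ (Alternating-map (suc (suc k)) suc alt)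
    L-zero : ∀ S → L (zero ∷ Vec.map suc S) ≡ - P S
    L-zero S = begin
      G″ S * (x zero * Φ (zero ∷ zero ∷ S⁺) + σ)
        ≡⟨ cong (λ z → G″ S * (z + σ)) (trans (cong (x zero *_) (repeated alt zero S⁺)) (zeroʳ (x zero))) ⟩
      G″ S * (0# + σ)
        ≡⟨ cong (G″ S *_) (+-identityˡ σ) ⟩
      G″ S * σ
        ≡⟨ cong (G″ S *_) (sumFin-cong m (λ w → trans (cong (x′ w *_) (swapped alt (suc w) zero S⁺))
                                                     (sym (-‿distribʳ-* (x′ w) _)))) ⟩
      G″ S * sumFin F m (λ w → - (x′ w * Φ″ (w ∷ S)))
        ≡⟨ cong (G″ S *_) (sumFin-neg m (λ w → x′ w * Φ″ (w ∷ S))) ⟨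
      G″ S * - sumFin F m (λ w → x′ w * Φ″ (w ∷ S))
        ≡⟨ -‿distribʳ-* (G″ S) _ ⟨
      - P S ∎
      where
      S⁺ = Vec.map suc S
      σ = sumFin F m (λ w → x′ w * Φ (suc w ∷ zero ∷ S⁺))
    L-suc : ∀ S → L (Vec.map suc S) ≡ A S + Q S
    L-suc S = trans (distribˡ (G′ S) _ _)
      (cong (_+ Q S) (solve 3 (λ g a f → g ⊕ (a ⊕ f) ⊜ (a ⊕ g) ⊕ f) refl (G′ S) (x zero) (Φ″ S)))
    W-zero : ∀ T → W (zero ∷ Vec.map suc T) ≡ A T + - P′ T
    W-zero T = begin
      wedge x G (zero ∷ Vec.map suc T) * Φ″ T                         ≡⟨ cong (_* Φ″ T) (wedge-zero∷map-suc x G T) ⟩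
      (x zero * G′ T + - wedge x′ G″ T) * Φ″ T                        ≡⟨ distribʳ (Φ″ T) _ _ ⟩
      A T + (- wedge x′ G″ T) * Φ″ T                                  ≡⟨ cong (λ s → A T + s) (-‿distribˡ-* _ _) ⟨
      A T + - P′ T                                                    ∎
    W-suc : ∀ T → W (Vec.map suc T) ≡ Q′ T
    W-suc T = cong (_* Φ′ T) (wedge-map-suc x G T)

  infixl 7 _⋆_
  _⋆_ : ∀ {k m} → (Fin k → Fin m → R) → (Fin m → Fin k → R) → Fin k → Fin k → R
  _⋆_ {m = m} M N a b = sumFin F m (λ w → M a w * N w b)

  detCols : {B : Set} → ∀ k → (Fin k → B → R) → Vec B k → R
  detCols k M S = det F k (λ a b → M a (lookup S b))

  wedge-detCols : ∀ k {m} (M : Fin (suc k) → Fin m → R) (T : Vec (Fin m) (suc k)) →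
    wedge (M zero) (detCols k (λ a → M (suc a))) T ≡ detCols (suc k) M T
  wedge-detCols k M T = sumFin-cong (suc k) (λ i → cong (λ d → sign F i * (M zero (lookup T i) * d))
    (det-cong k (λ a b → cong (M (suc a)) (lookup-removeAt T i b))))

  cauchy-binet : ∀ k m (M : Fin k → Fin m → R) (N : Fin m → Fin k → R) →
    det F k (M ⋆ N) ≡ sumSubsets k m (λ S → detCols k M S * detRows k N S)
  cauchy-binet zero    m M N = sym (*-identityˡ 1#)
  cauchy-binet (suc k) m M N = begin
    sumFin F (suc k) (λ j → sign F j * ((M ⋆ N) zero j * det F k (M′ ⋆ N′ j)))
      ≡⟨ sumFin-cong (suc k) (λ j → cong (λ d → sign F j * ((M ⋆ N) zero j * d)) (cauchy-binet k m M′ (N′ j))) ⟩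
    sumFin F (suc k) (λ j → sign F j * ((M ⋆ N) zero j * sumSubsets k m (λ S → G S * H j S)))
      ≡⟨ sumFin-cong (suc k) expand ⟩
    sumFin F (suc k) (λ j → sumSubsets k m (λ S → sumFin F m (λ w → term j S w)))
      ≡⟨ sumSubsets-sumFin k m (suc k) (λ j S → sumFin F m (λ w → term j S w)) ⟨
    sumSubsets k m (λ S → sumFin F (suc k) (λ j → sumFin F m (λ w → term j S w)))
      ≡⟨ sumSubsets-cong k m (λ S → sumFin-comm (suc k) m (λ j w → term j S w)) ⟩
    sumSubsets k m (λ S → sumFin F m (λ w → sumFin F (suc k) (λ j → term j S w)))
      ≡⟨ sumSubsets-cong k m factor ⟩
    sumSubsets k m (λ S → G S * sumFin F m (λ w → M zero w * detRows (suc k) N (w ∷ S)))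
      ≡⟨ sumSubsets-wedge k m (M zero) G (detRows-alternating (suc k) N) ⟩
    sumSubsets (suc k) m (λ T → wedge (M zero) G T * detRows (suc k) N T)
      ≡⟨ sumSubsets-cong (suc k) m (λ T → cong (_* detRows (suc k) N T) (wedge-detCols k M T)) ⟩
    sumSubsets (suc k) m (λ T → detCols (suc k) M T * detRows (suc k) N T) ∎
    where
    M′ = λ a → M (suc a)
    N′ = λ j w c → N w (punchIn j c)
    G = detCols k M′
    H = λ j → detRows k (N′ j)
    term : Fin (suc k) → Vec (Fin m) k → Fin m → R
    term j S w = sign F j * ((M zero w * N w j) * (G S * H j S))
    expand : ∀ j → sign F j * ((M ⋆ N) zero j * sumSubsets k m (λ S → G S * H j S)) ≡
                   sumSubsets k m (λ S → sumFin F m (λ w → term j S w))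
    expand j = begin
      sign F j * ((M ⋆ N) zero j * sumSubsets k m (λ S → G S * H j S))
        ≡⟨ cong (sign F j *_) (sumSubsets-*ˡ k m _ (λ S → G S * H j S)) ⟩
      sign F j * sumSubsets k m (λ S → (M ⋆ N) zero j * (G S * H j S))
        ≡⟨ sumSubsets-*ˡ k m (sign F j) _ ⟩
      sumSubsets k m (λ S → sign F j * ((M ⋆ N) zero j * (G S * H j S)))
        ≡⟨ sumSubsets-cong k m (λ S → trans (cong (sign F j *_) (sumFin-*ʳ m (G S * H j S) (λ w → M zero w * N w j)))
                                            (sumFin-*ˡ m (sign F j) (λ w → (M zero w * N w j) * (G S * H j S)))) ⟩
      sumSubsets k m (λ S → sumFin F m (λ w → term j S w)) ∎
    factor : ∀ S → sumFin F m (λ w → sumFin F (suc k) (λ j → term j S w)) ≡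
                   G S * sumFin F m (λ w → M zero w * detRows (suc k) N (w ∷ S))
    factor S = begin
      sumFin F m (λ w → sumFin F (suc k) (λ j → term j S w))
        ≡⟨ sumFin-cong m (λ w → sumFin-cong (suc k) (λ j → regroup (sign F j) (M zero w) (N w j) (G S) (H j S))) ⟩
      sumFin F m (λ w → sumFin F (suc k) (λ j → G S * (M zero w * (sign F j * (N w j * H j S)))))
        ≡⟨ sumFin-cong m (λ w → sym (trans (cong (G S *_) (sumFin-*ˡ (suc k) (M zero w) (λ j → sign F j * (N w j * H j S))))
                                             (sumFin-*ˡ (suc k) (G S) (λ j → M zero w * (sign F j * (N w j * H j S)))))) ⟩
      sumFin F m (λ w → G S * (M zero w * detRows (suc k) N (w ∷ S)))
        ≡⟨ sumFin-*ˡ m (G S) (λ w → M zero w * detRows (suc k) N (w ∷ S)) ⟨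
      G S * sumFin F m (λ w → M zero w * detRows (suc k) N (w ∷ S)) ∎
      where
      regroup : ∀ s a n g h → s * ((a * n) * (g * h)) ≡ g * (a * (s * (n * h)))
      regroup = solve 5 (λ s a n g h → s ⊕ ((a ⊕ n) ⊕ (g ⊕ h)) ⊜ g ⊕ (a ⊕ (s ⊕ (n ⊕ h)))) refl

  -- Sums over intervals of ℤ

  sumFrom : ℤ → ℕ → (ℤ → R) → R
  sumFrom b zero    f = 0#
  sumFrom b (suc n) f = f b + sumFrom (ℤ.suc b) n f

  sumFin-shift : ∀ n c (f : ℤ → R) → sumFin F n (λ i → f (+ toℕ i ℤ.+ c)) ≡ sumFrom c n f
  sumFin-shift zero    c f = refl
  sumFin-shift (suc n) c f = cong₂ _+_ (cong f (ℤₚ.+-identityˡ c))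
    (trans (sumFin-cong n (λ i → cong f (shift (+ toℕ i) c))) (sumFin-shift n (ℤ.suc c) f))
    where
    shift : ∀ y c → (1ℤ ℤ.+ y) ℤ.+ c ≡ y ℤ.+ (1ℤ ℤ.+ c)
    shift = solve-∀

  sumFrom-++ : ∀ m n b (f : ℤ → R) → sumFrom b (m ℕ.+ n) f ≡ sumFrom b m f + sumFrom (b ℤ.+ + m) n f
  sumFrom-++ zero    n b f = sym (trans (+-identityˡ _) (cong (λ c → sumFrom c n f) (ℤₚ.+-identityʳ b)))
  sumFrom-++ (suc m) n b f = begin
    f b + sumFrom (ℤ.suc b) (m ℕ.+ n) f
      ≡⟨ cong (λ s → f b + s) (sumFrom-++ m n (ℤ.suc b) f) ⟩
    f b + (sumFrom (ℤ.suc b) m f + sumFrom (ℤ.suc b ℤ.+ + m) n f)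
      ≡⟨ +-assoc _ _ _ ⟨
    (f b + sumFrom (ℤ.suc b) m f) + sumFrom (ℤ.suc b ℤ.+ + m) n f
      ≡⟨ cong (λ c → (f b + sumFrom (ℤ.suc b) m f) + sumFrom c n f) (shift b (+ m)) ⟩
    (f b + sumFrom (ℤ.suc b) m f) + sumFrom (b ℤ.+ + suc m) n f ∎
    where
    shift : ∀ b y → (1ℤ ℤ.+ b) ℤ.+ y ≡ b ℤ.+ (1ℤ ℤ.+ y)
    shift = solve-∀

  sumFrom-above : ∀ {f : ℤ → R} {c} → (∀ w → c ℤ.≤ w → f w ≡ 0#) → ∀ n {b} → c ℤ.≤ b → sumFrom b n f ≡ 0#
  sumFrom-above vanish zero    c≤b = refl
  sumFrom-above vanish (suc n) c≤b =
    trans (cong₂ _+_ (vanish _ c≤b) (sumFrom-above vanish n (ℤₚ.i≤j⇒i≤1+j c≤b))) (+-identityˡ 0#)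

  sumFrom-support : ∀ {f : ℤ → R} {lo len} →
    (∀ w → w ℤ.< lo → f w ≡ 0#) → (∀ w → lo ℤ.+ + len ℤ.≤ w → f w ≡ 0#) →
    ∀ L {b} → b ℤ.≤ lo → lo ℤ.+ + len ℤ.≤ b ℤ.+ + L → sumFrom b L f ≡ sumFrom lo len f
  sumFrom-support {f} {lo} {len} below above L {b} b≤lo hi≤ with b ℤₚ.≟ lo
  ... | yes refl = begin
    sumFrom lo L f                                              ≡⟨ cong (λ n → sumFrom lo n f) (ℕₚ.m+[n∸m]≡n len≤L) ⟨
    sumFrom lo (len ℕ.+ (L ℕ.∸ len)) f                          ≡⟨ sumFrom-++ len (L ℕ.∸ len) lo f ⟩
    sumFrom lo len f + sumFrom (lo ℤ.+ + len) (L ℕ.∸ len) f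
      ≡⟨ cong (λ s → sumFrom lo len f + s) (sumFrom-above above (L ℕ.∸ len) ℤₚ.≤-refl) ⟩
    sumFrom lo len f + 0#                                       ≡⟨ +-identityʳ _ ⟩
    sumFrom lo len f                                            ∎
    where
    cancel : ∀ b x → ℤ.- b ℤ.+ (b ℤ.+ x) ≡ x
    cancel = solve-∀
    len≤L : len ℕ.≤ L
    len≤L = ℤₚ.drop‿+≤+ (subst₂ ℤ._≤_ (cancel lo (+ len)) (cancel lo (+ L)) (ℤₚ.+-monoʳ-≤ (ℤ.- lo) hi≤))
  ... | no b≢lo with L
  ...   | zero  = ⊥-elim (ℤₚ.<-irrefl refl (ℤₚ.<-≤-trans b<lo (ℤₚ.≤-trans (ℤₚ.i≤i+j lo (+ len))
                     (subst (lo ℤ.+ + len ℤ.≤_) (ℤₚ.+-identityʳ b) hi≤))))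
    where
    b<lo = ℤₚ.≤∧≢⇒< b≤lo b≢lo
  ...   | suc L′ = trans (cong₂ _+_ (below b b<lo) (sumFrom-support below above L′ (ℤₚ.i<j⇒suc[i]≤j b<lo) hi≤′))
                         (+-identityˡ _)
    where
    b<lo = ℤₚ.≤∧≢⇒< b≤lo b≢lo
    shift : ∀ b y → b ℤ.+ (1ℤ ℤ.+ y) ≡ (1ℤ ℤ.+ b) ℤ.+ y
    shift = solve-∀
    hi≤′ : lo ℤ.+ + len ℤ.≤ ℤ.suc b ℤ.+ + L′
    hi≤′ = subst (lo ℤ.+ + len ℤ.≤_) (shift b (+ L′)) hi≤

  sumFrom-blocks : ∀ t n X (f : ℤ → R) →
    sumFrom (X ℤ.* + t) (n ℕ.* t) f ≡ sumFrom X n (λ Y → sumFin F t (λ l → f (+ toℕ l ℤ.+ Y ℤ.* + t)))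
  sumFrom-blocks t zero    X f = refl
  sumFrom-blocks t (suc n) X f = begin
    sumFrom (X ℤ.* + t) (t ℕ.+ n ℕ.* t) f
      ≡⟨ sumFrom-++ t (n ℕ.* t) (X ℤ.* + t) f ⟩
    sumFrom (X ℤ.* + t) t f + sumFrom (X ℤ.* + t ℤ.+ + t) (n ℕ.* t) f
      ≡⟨ cong₂ _+_ (sym (sumFin-shift t (X ℤ.* + t) f)) (cong (λ c → sumFrom c (n ℕ.* t) f) (next-block X (+ t))) ⟩
    sumFin F t (λ l → f (+ toℕ l ℤ.+ X ℤ.* + t)) + sumFrom (ℤ.suc X ℤ.* + t) (n ℕ.* t) f
      ≡⟨ cong (λ s → sumFin F t (λ l → f (+ toℕ l ℤ.+ X ℤ.* + t)) + s) (sumFrom-blocks t n (ℤ.suc X) f) ⟩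
    sumFin F t (λ l → f (+ toℕ l ℤ.+ X ℤ.* + t)) +
      sumFrom (ℤ.suc X) n (λ Y → sumFin F t (λ l → f (+ toℕ l ℤ.+ Y ℤ.* + t))) ∎
    where
    next-block : ∀ X t → X ℤ.* t ℤ.+ t ≡ (1ℤ ℤ.+ X) ℤ.* t
    next-block = solve-∀

  sumSym≡sumFrom : ∀ N (f : ℤ → R) → sumSym F N f ≡ sumFrom (ℤ.- (+ N)) (suc (N ℕ.+ N)) f
  sumSym≡sumFrom N f = sumFin-shift (suc (N ℕ.+ N)) (ℤ.- (+ N)) f

  finiteSum-support : ∀ {f : ℤ → R} {lo len} →
    (∀ w → w ℤ.< lo → f w ≡ 0#) → (∀ w → lo ℤ.+ + len ℤ.≤ w → f w ≡ 0#) → FiniteSumIs F f (sumFrom lo len f)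
  finiteSum-support {f} {lo} {len} below above = N , vanish , sum-eq
    where
    N = ∣ lo ∣ ℕ.+ len
    -N≤lo : ℤ.- (+ N) ℤ.≤ lo
    -N≤lo = ℤₚ.≤-trans (ℤₚ.neg-mono-≤ (+≤+ (ℕₚ.m≤m+n ∣ lo ∣ len))) (-∣i∣≤i lo)
    hi≤N : lo ℤ.+ + len ℤ.≤ + N
    hi≤N = ℤₚ.+-monoˡ-≤ (+ len) (i≤+∣i∣ lo)
    vanish : ∀ w → N ℕ.< ∣ w ∣ → f w ≡ 0#
    vanish w N<∣w∣ with n<∣i∣⇒i<-n⊎n<i N w N<∣w∣
    ... | inj₁ w<-N = below w (ℤₚ.<-≤-trans w<-N -N≤lo)
    ... | inj₂ N<w  = above w (ℤₚ.<⇒≤ (ℤₚ.≤-<-trans hi≤N N<w))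
    sum-eq : sumSym F N f ≡ sumFrom lo len f
    sum-eq = trans (sumSym≡sumFrom N f) (sumFrom-support below above (suc (N ℕ.+ N)) -N≤lo
      (subst (lo ℤ.+ + len ℤ.≤_) (sym (-N+[1+2N]≡1+N N)) (ℤₚ.≤-trans hi≤N (ℤₚ.i≤suc[i] (+ N)))))

  finiteSum-extend : ∀ {f : ℤ → R} {N₀ N} →
    (∀ w → N₀ ℕ.< ∣ w ∣ → f w ≡ 0#) → N₀ ℕ.≤ N → sumSym F N f ≡ sumSym F N₀ f
  finiteSum-extend {f} {N₀} {N} vanish N₀≤N = begin
    sumSym F N f                                  ≡⟨ sumSym≡sumFrom N f ⟩
    sumFrom (ℤ.- (+ N)) (suc (N ℕ.+ N)) f         ≡⟨ sumFrom-support below above (suc (N ℕ.+ N)) (ℤₚ.neg-mono-≤ (+≤+ N₀≤N)) hi≤ ⟩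
    sumFrom (ℤ.- (+ N₀)) (suc (N₀ ℕ.+ N₀)) f      ≡⟨ sumSym≡sumFrom N₀ f ⟨
    sumSym F N₀ f                                 ∎
    where
    below : ∀ w → w ℤ.< ℤ.- (+ N₀) → f w ≡ 0#
    below w w<-N₀ = vanish w (i<-n⇒n<∣i∣ w<-N₀)
    above : ∀ w → ℤ.- (+ N₀) ℤ.+ + suc (N₀ ℕ.+ N₀) ℤ.≤ w → f w ≡ 0#
    above w hi≤w = vanish w (+n<i⇒n<∣i∣ (ℤₚ.suc[i]≤j⇒i<j (subst (ℤ._≤ w) (-N+[1+2N]≡1+N N₀) hi≤w)))
    hi≤ : ℤ.- (+ N₀) ℤ.+ + suc (N₀ ℕ.+ N₀) ℤ.≤ ℤ.- (+ N) ℤ.+ + suc (N ℕ.+ N)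
    hi≤ = subst₂ ℤ._≤_ (sym (-N+[1+2N]≡1+N N₀)) (sym (-N+[1+2N]≡1+N N)) (+≤+ (ℕ.s≤s N₀≤N))

  -- Products of totally positive matrices

  open IsTotalOrder isTotalOrder using () renaming (refl to ≤-refl; trans to ≤-trans)

  +-nonneg : ∀ {x y} → 0# ≤ x → 0# ≤ y → 0# ≤ x + y
  +-nonneg {x} {y} 0≤x 0≤y = ≤-trans
    (subst₂ _≤_ (+-identityʳ 0#) (+-identityʳ x) (+-mono-≤ 0# 0≤x))
    (subst₂ _≤_ (+-identityˡ x) (+-comm y x) (+-mono-≤ x 0≤y))

  sumSubsets-nonneg : ∀ k m (G : Vec (Fin m) k → R) → (∀ S → Increasing S → 0# ≤ G S) → 0# ≤ sumSubsets k m G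
  sumSubsets-nonneg zero    m       G nonneg = nonneg [] (λ ())
  sumSubsets-nonneg (suc k) zero    G nonneg = ≤-refl
  sumSubsets-nonneg (suc k) (suc m) G nonneg = +-nonneg
    (sumSubsets-nonneg k m _ (λ S inc → nonneg _ (Increasing-zero∷map-suc S inc)))
    (sumSubsets-nonneg (suc k) m _ (λ S inc → nonneg _ (Increasing-map-suc S inc)))

  totallyPositive-product : ∀ {M N P : ZMatrix F} → IsZProduct F M N P →
    TotallyPositive F M → TotallyPositive F N → TotallyPositive F P
  totallyPositive-product {M} {N} {P} product tpM tpN k rows cols rows↑ cols↑ =
    subst (0# ≤_) (sym det-sub≡) (sumSubsets-nonneg k (suc (L ℕ.+ L)) _ (λ S S↑ →
      *-nonneg (tpM k rows (window ∘ lookup S) rows↑ (window↑ S S↑)) (tpN k (window ∘ lookup S) cols (window↑ S S↑) cols↑)))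
    where
    -- On the window [-L, L] every entry of the submatrix of P is an entry of M′ ⋆ N′.
    L = proj₁ (finite-upperBound² k k (λ a b → proj₁ (product (rows a) (cols b))))
    bound≤L = proj₂ (finite-upperBound² k k (λ a b → proj₁ (product (rows a) (cols b))))
    window : Fin (suc (L ℕ.+ L)) → ℤ
    window c = + toℕ c ℤ.- + L
    window↑ : ∀ (S : Vec (Fin (suc (L ℕ.+ L))) k) → Increasing S → StrictlyIncreasing F (window ∘ lookup S)
    window↑ S S↑ a b a<b = ℤₚ.+-monoˡ-< (ℤ.- (+ L)) (+<+ (S↑ a b a<b))
    M′ : Fin k → Fin (suc (L ℕ.+ L)) → R
    M′ a c = M (rows a) (window c)
    N′ : Fin (suc (L ℕ.+ L)) → Fin k → R
    N′ c b = N (window c) (cols b)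
    entry≡ : ∀ a b → P (rows a) (cols b) ≡ (M′ ⋆ N′) a b
    entry≡ a b = trans (sym (proj₂ (proj₂ (product (rows a) (cols b)))))
                       (sym (finiteSum-extend (proj₁ (proj₂ (product (rows a) (cols b)))) (bound≤L a b)))
    det-sub≡ : det F k (λ a b → P (rows a) (cols b)) ≡ sumSubsets k (suc (L ℕ.+ L)) (λ S → detCols k M′ S * detRows k N′ S)
    det-sub≡ = trans (det-cong k entry≡) (cauchy-binet k (suc (L ℕ.+ L)) M′ N′)

  -- Lace

  coeffℤ-negative : ∀ (a : Series F) {x y} → x ℤ.< y → coeffℤ F a (x ℤ.- y) ≡ 0#
  coeffℤ-negative a {x} {y} x<y = at-negative (subst (x ℤ.- y ℤ.<_) (ℤₚ.+-inverseʳ y) (ℤₚ.+-monoˡ-< (ℤ.- y) x<y))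
    where
    at-negative : ∀ {i} → i ℤ.< + 0 → coeffℤ F a i ≡ 0#
    at-negative { -[1+ n ]} _ = refl
    at-negative {+ n}       (+<+ ())

  sumUpTo-head : ∀ n (h : ℕ → R) → sumUpTo F (suc n) h ≡ h 0 + sumUpTo F n (λ k → h (suc k))
  sumUpTo-head zero    h = refl
  sumUpTo-head (suc n) h = trans (cong (_+ h (suc (suc n))) (sumUpTo-head n h)) (+-assoc _ _ _)

  sumFin≡sumUpTo : ∀ n (h : ℕ → R) → sumFin F (suc n) (λ k → h (toℕ k)) ≡ sumUpTo F n h
  sumFin≡sumUpTo zero    h = +-identityʳ (h 0)
  sumFin≡sumUpTo (suc n) h =
    trans (cong (λ s → h 0 + s) (sumFin≡sumUpTo n (λ k → h (suc k)))) (sym (sumUpTo-head n h))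

  module _ {p t q : ℕ} ⦃ _ : NonZero p ⦄ ⦃ _ : NonZero t ⦄ ⦃ _ : NonZero q ⦄
           (A : PSMatrix F p t) (B : PSMatrix F t q) where

    laceTerm : ℤ → ℤ → ℤ → R
    laceTerm u v w = Lace F A u w * Lace F B w v

    laceTerm-below : ∀ u v w → w ℤ.< (u /ℕ p) ℤ.* + t → laceTerm u v w ≡ 0#
    laceTerm-below u v w w<Ut =
      trans (cong (_* Lace F B w v) (coeffℤ-negative _ (w<X*t⇒w/t<X t (u /ℕ p) w<Ut))) (zeroˡ _)

    laceTerm-above : ∀ u v w → ℤ.suc (v /ℕ q) ℤ.* + t ℤ.≤ w → laceTerm u v w ≡ 0#
    laceTerm-above u v w [1+V]t≤w =
      trans (cong (Lace F A u w *_) (coeffℤ-negative _ V<w/t)) (zeroʳ _)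
      where
      V<w/t : v /ℕ q ℤ.< w /ℕ t
      V<w/t = ℤₚ.suc[i]≤j⇒i<j (X*t≤w⇒X≤w/t t (ℤ.suc (v /ℕ q)) [1+V]t≤w)

    laceTerm-disjoint : ∀ u v → v /ℕ q ℤ.< u /ℕ p → ∀ w → laceTerm u v w ≡ 0#
    laceTerm-disjoint u v V<U w with w /ℕ t ℤₚ.<? u /ℕ p
    ... | yes w/t<U = trans (cong (_* Lace F B w v) (coeffℤ-negative _ w/t<U)) (zeroˡ _)
    ... | no  w/t≮U = trans (cong (Lace F A u w *_) (coeffℤ-negative _ (ℤₚ.<-≤-trans V<U (ℤₚ.≮⇒≥ w/t≮U)))) (zeroʳ _)

    laceTerm-block : ∀ u v Y (l : Fin t) → laceTerm u v (+ toℕ l ℤ.+ Y ℤ.* + t) ≡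
      coeffℤ F (A (fromℕ< (n%ℕd<d u p)) l) (Y ℤ.- u /ℕ p) * coeffℤ F (B l (fromℕ< (n%ℕd<d v q))) (v /ℕ q ℤ.- Y)
    laceTerm-block u v Y l = cong₂
      (λ l′ Y′ → coeffℤ F (A (fromℕ< (n%ℕd<d u p)) l′) (Y′ ℤ.- u /ℕ p) * coeffℤ F (B l′ (fromℕ< (n%ℕd<d v q))) (v /ℕ q ℤ.- Y′))
      (toℕ-injective (trans (toℕ-fromℕ< _) ([l+X*t]%t≡l t Y (toℕ<n l))))
      ([l+X*t]/t≡X t Y (toℕ<n l))

    laceTerm-sum : ∀ u v n → v /ℕ q ℤ.- u /ℕ p ≡ + n →
      sumFrom ((u /ℕ p) ℤ.* + t) (suc n ℕ.* t) (laceTerm u v) ≡ matMul F A B (fromℕ< (n%ℕd<d u p)) (fromℕ< (n%ℕd<d v q)) n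
    laceTerm-sum u v n V-U≡n = begin
      sumFrom (U ℤ.* + t) (suc n ℕ.* t) (laceTerm u v)
        ≡⟨ sumFrom-blocks t (suc n) U (laceTerm u v) ⟩
      sumFrom U (suc n) (λ Y → sumFin F t (λ l → laceTerm u v (+ toℕ l ℤ.+ Y ℤ.* + t)))
        ≡⟨ sumFin-shift (suc n) U _ ⟨
      sumFin F (suc n) (λ k → sumFin F t (λ l → laceTerm u v (+ toℕ l ℤ.+ (+ toℕ k ℤ.+ U) ℤ.* + t)))
        ≡⟨ sumFin-cong (suc n) (λ k → sumFin-cong t (λ l → trans (laceTerm-block u v (+ toℕ k ℤ.+ U) l)
             (cong₂ _*_ (cong (coeffℤ F (A i l)) (k+U-U≡k (+ toℕ k) U)) (cong (coeffℤ F (B l j)) (V-[k+U]≡n∸k k))))) ⟩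
      sumFin F (suc n) (λ k → sumFin F t (λ l → A i l (toℕ k) * B l j (n ℕ.∸ toℕ k)))
        ≡⟨ sumFin-comm (suc n) t (λ k l → A i l (toℕ k) * B l j (n ℕ.∸ toℕ k)) ⟩
      sumFin F t (λ l → sumFin F (suc n) (λ k → A i l (toℕ k) * B l j (n ℕ.∸ toℕ k)))
        ≡⟨ sumFin-cong t (λ l → sumFin≡sumUpTo n (λ k → A i l k * B l j (n ℕ.∸ k))) ⟩
      matMul F A B i j n ∎
      where
      U = u /ℕ p
      V = v /ℕ q
      i = fromℕ< (n%ℕd<d u p)
      j = fromℕ< (n%ℕd<d v q)
      k+U-U≡k : ∀ k U → (k ℤ.+ U) ℤ.- U ≡ k
      k+U-U≡k = solve-∀
      cancel-U : ∀ n k U → (n ℤ.+ U) ℤ.- (k ℤ.+ U) ≡ n ℤ.- k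
      cancel-U = solve-∀
      V-[k+U]≡n∸k : ∀ (k : Fin (suc n)) → V ℤ.- (+ toℕ k ℤ.+ U) ≡ + (n ℕ.∸ toℕ k)
      V-[k+U]≡n∸k k = begin
        V ℤ.- (+ toℕ k ℤ.+ U)                ≡⟨ cong (λ V′ → V′ ℤ.- (+ toℕ k ℤ.+ U)) (i-j≡k⇒i≡k+j V U V-U≡n) ⟩
        (+ n ℤ.+ U) ℤ.- (+ toℕ k ℤ.+ U)      ≡⟨ cancel-U (+ n) (+ toℕ k) U ⟩
        + n ℤ.- + toℕ k                      ≡⟨ ℤₚ.[+m]-[+n]≡m⊖n n (toℕ k) ⟩
        n ℤ.⊖ toℕ k                          ≡⟨ ℤₚ.⊖-≥ (ℕ.s≤s⁻¹ (toℕ<n k)) ⟩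
        + (n ℕ.∸ toℕ k)                      ∎

    laceTerm-finiteSum : ∀ u v d → v /ℕ q ℤ.- u /ℕ p ≡ d →
      FiniteSumIs F (laceTerm u v) (coeffℤ F (matMul F A B (fromℕ< (n%ℕd<d u p)) (fromℕ< (n%ℕd<d v q))) d)
    laceTerm-finiteSum u v (+ n) V-U≡n = subst (FiniteSumIs F (laceTerm u v)) (laceTerm-sum u v n V-U≡n)
      (finiteSum-support (laceTerm-below u v) (λ w end≤w →
        laceTerm-above u v w (subst (ℤ._≤ w) (U*t+[1+n]*t≡[1+V]*t (u /ℕ p) (v /ℕ q) t n V-U≡n) end≤w)))
    laceTerm-finiteSum u v -[1+ k ] V-U<0 = finiteSum-support {lo = + 0} {len = 0} (λ w _ → vanish w) (λ w _ → vanish w)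
      where
      vanish = laceTerm-disjoint u v (i-j≡-[1+n]⇒i<j (v /ℕ q) (u /ℕ p) V-U<0)

    lace-product : IsZProduct F (Lace F A) (Lace F B) (Lace F (matMul F A B))
    lace-product u v = laceTerm-finiteSum u v _ refl

theorem4p3 : (F : RealField) (p t q : ℕ) → ⦃ _ : NonZero p ⦄ → ⦃ _ : NonZero t ⦄ → ⦃ _ : NonZero q ⦄ →
    (A : PSMatrix F p t) (B : PSMatrix F t q) →
    IsZProduct F (Lace F A) (Lace F B) (Lace F (matMul F A B))
    × (FullyInterlacing F A → FullyInterlacing F B → FullyInterlacing F (matMul F A B))
theorem4p3 F p t q A B = lace-product F A B , totallyPositive-product F (lace-product F A B)
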